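{- Let $a,b,c\in\mathbb{N}$ with $a\le b\le c$, $3a=b+c$ and $(a,b,c)\neq(4,6,6)$. Then $f(a,b,c)=\left\lfloor \frac{a+b+c}{2}\right\rfloor-1$.
   Context: $\mathbb{N}$ denotes the positive integers and $[n]=\{1,\dots,n\}$. For $a,b,c\in\mathbb{N}$, $f(a,b,c)$ denotes the metric dimension of the Cartesian product $K_a\times K_b\times K_c$ of complete graphs (vertex set $[a]\times[b]\times[c]$, two triples adjacent iff they differ in exactly one coordinate); the metric dimension of a graph is the minimum size of a vertex set $U$ such that every vertex is uniquely determined by its vector of distances to the vertices of $U$. Equivalently, $f(a,b,c)$ is the minimum cardinality of a set $Q\subseteq[a]\times[b]\times[c]$ such that for all distinct $s,s'$ there is $q\in Q$ with $g(s,q)\neq g(s',q)$, where $g(s,q)$ is the number of indices $i\in[3]$ with $s_i=q_i$. -}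

module Defs where

open import Data.Nat using (ℕ; zero; suc; _+_; _≤_)
open import Data.Fin using (Fin)
open import Data.Fin.Properties using (_≟_)
open import Data.Product using (_×_; _,_; Σ-syntax)
open import Data.List using (List; length)
open import Data.List.Relation.Unary.Unique.Propositional using (Unique)
open import Data.List.Relation.Unary.Any using (Any)
open import Relation.Nullary using (¬_; yes; no)
open import Relation.Binary.PropositionalEquality using (_≡_)

Vertex : ℕ → ℕ → ℕ → Set
Vertex a b c = Fin a × Fin b × Fin c

diff : {n : ℕ} → Fin n → Fin n → ℕ
diff i j with i ≟ j
... | yes _ = 0
... | no _ = 1

-- Graph distance in K_a × K_b × K_c (a Hamming graph): number of
-- coordinates in which the two triples differ.
dist : {a b c : ℕ} → Vertex a b c → Vertex a b c → ℕ
dist (x₁ , x₂ , x₃) (y₁ , y₂ , y₃) = diff x₁ y₁ + diff x₂ y₂ + diff x₃ y₃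

Resolving : {a b c : ℕ} → List (Vertex a b c) → Set
Resolving {a} {b} {c} U =
  (s s' : Vertex a b c) → ¬ s ≡ s' → Any (λ q → ¬ dist s q ≡ dist s' q) U

MetricDim : ℕ → ℕ → ℕ → ℕ → Set
MetricDim a b c k =
  (Σ[ U ∈ List (Vertex a b c) ] (Unique U × Resolving U × length U ≡ k))
  × ((U : List (Vertex a b c)) → Unique U → Resolving U → k ≤ length U)

-- Put a = 2m + d, b = a + m and c = b + d; then a + b + c = 4a and the claim is f = 2a - 1.
--
-- Let U be a resolving set of L points. A value of a coordinate is unused if no
-- point of U takes it, and a point of U is lonely in a coordinate if no other point of U shares
-- its value there. Counting the values of a coordinate with n values gives 2n ≤ L + S + 2Z,
-- where S counts the lonely points and Z the unused values. Two vertices differing in a single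
-- coordinate, in two unused values, are unresolved, so Z ≤ 1. Swapping two coordinates between
-- two vertices shows that at most one point is lonely in both of them, and none if both have an
-- unused value. Summing over the three coordinates and the three pairs of coordinates gives
-- 2(a + b + c) ≤ 4L + 6, that is L ≥ 2a - 1.
--
-- Point sets of two blocks are glued block-diagonally into X ⊕ Q. Seen from one
-- block, a vertex is a partial vertex, some of its coordinates lying outside the block; the
-- invariant carried along is that partial vertices with equal supports are resolved. Two small
-- gadgets, in K₂ × K₂ × K₄ and K₂ × K₄ × K₂, confuse only one kind of pair of partial vertices,
-- and the other block tells the corresponding pair of high parts apart. Gluing a gadget adds
-- (2, 2, 4) or (2, 4, 2) to (a, b, c) and 4 points, and from base cases checked by computation
-- this reaches every (m, d) except (m, d) = (2, 0), which is (a, b, c) = (4, 6, 6).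
{-# OPTIONS --safe #-}
module Submission where

open import Defs
open import Data.Nat using (ℕ; _+_; _*_; _∸_; _≤_; NonZero; _/_)
open import Data.Product using (_×_; _,_)
open import Relation.Nullary using (¬_)
open import Relation.Binary.PropositionalEquality using (_≡_)

open import Algebra.Properties.CommutativeSemigroup using (interchange)
open import Data.Bool using (Bool; true; false; _∧_; not; if_then_else_)
import Data.Bool.Properties as Bool
open import Data.Fin using (Fin; zero; suc; _↑ˡ_; _↑ʳ_; splitAt; #_)
open import Data.Fin.Properties
  using (_≟_; splitAt-↑ˡ; splitAt-↑ʳ; splitAt⁻¹-↑ˡ; splitAt⁻¹-↑ʳ; ↑ˡ-injective; ↑ʳ-injective)
import Data.Fin.Properties as Fin
open import Data.List using (List; []; _∷_; map; foldr; _++_; length; allFin; cartesianProduct)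
open import Data.List.Membership.Propositional using (_∈_)
open import Data.List.Membership.Propositional.Properties
  using (∈-allFin; ∈-map⁺; ∈-map⁻; ∈-cartesianProduct⁺)
open import Data.List.Properties
  using (map-cong; map-cong-local; map-∘; length-map; length-++; length-tabulate)
open import Data.List.Relation.Unary.All as All using (All; []; _∷_)
open import Data.List.Relation.Unary.All.Properties using (Any¬⇒¬All; ¬All⇒Any¬; ++⁻; map⁻)
open import Data.List.Relation.Unary.AllPairs using (AllPairs; []; _∷_)
import Data.List.Relation.Unary.AllPairs.Properties as AllPairs
import Data.List.Relation.Unary.Any as Any
open import Data.List.Relation.Unary.Any using (here; there)
import Data.List.Relation.Unary.Any.Properties as Any
open import Data.List.Relation.Unary.Unique.DecPropositional using (unique?)
open import Data.List.Relation.Unary.Unique.Propositional using (Unique)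
import Data.List.Relation.Unary.Unique.Propositional.Properties as Unique
open import Data.List.Relation.Unary.Unique.Propositional.Properties using (allFin⁺)
open import Data.Maybe using (Maybe; just; nothing; is-just)
import Data.Maybe.Properties as Maybe
open import Data.Nat using (zero; suc; _<_; z≤n; s≤s)
open import Data.Nat.DivMod using (m*n/n≡m)
open import Data.Nat.ListAction using (sum)
open import Data.Nat.Properties
  using ( +-assoc; +-comm; +-identityʳ; +-commutativeSemigroup; +-mono-≤; +-monoʳ-<; +-cancelʳ-≤
        ; +-cancelˡ-≡; *-identityˡ; *-identityʳ; *-zeroʳ; *-distribˡ-+; *-mono-≤; *-cancelˡ-<
        ; ∸-monoˡ-≤; suc-injective; ≤-refl; ≤-reflexive; ≤-trans; ≤-pred; m≤n+m; ≤ᵇ⇒≤; ≰⇒>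
        ; n<1⇒n≡0; n≤1⇒n≡0∨n≡1; m≤n⇒∃[o]m+o≡n; module ≤-Reasoning)
import Data.Nat.Properties as ℕ
open import Data.Nat.Tactic.RingSolver using (solve-∀)
open import Data.Product using (Σ-syntax; ∃-syntax; proj₁; proj₂)
open import Data.Product.Properties using (≡-dec)
open import Data.Sum using (_⊎_; inj₁; inj₂)
open import Data.Unit using (tt)
open import Function using (_∘_; id)
open import Relation.Binary.Definitions using (DecidableEquality)
open import Relation.Binary.PropositionalEquality
  using (_≢_; refl; sym; trans; cong; cong₂; subst; subst₂; ≢-sym; module ≡-Reasoning)
open import Relation.Nullary
  using (Dec; yes; no; does; contradiction; ¬?; _×-dec_; _⊎-dec_; _→-dec_)
open import Relation.Nullary.Decidable
  using (map′; decidable-stable; dec-true; dec-false; True; toWitness; from-yes)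
open import Relation.Unary using (Decidable)

diff-≢ : {n : ℕ} {i j : Fin n} → i ≢ j → diff i j ≡ 1
diff-≢ {i = i} {j} i≢j with i ≟ j
... | yes i≡j = contradiction i≡j i≢j
... | no _    = refl

diff-cong : {m n : ℕ} {i j : Fin m} {k l : Fin n} →
            (i ≡ j → k ≡ l) → (k ≡ l → i ≡ j) → diff i j ≡ diff k l
diff-cong {i = i} {j} {k} {l} to from with i ≟ j | k ≟ l
... | yes _   | yes _   = refl
... | yes i≡j | no k≢l = contradiction (to i≡j) k≢l
... | no i≢j  | yes k≡l = contradiction (from k≡l) i≢j
... | no _    | no _    = refl

module _ {a b c : ℕ} where

  _≟ᵛ_ : DecidableEquality (Vertex a b c)
  _≟ᵛ_ = ≡-dec _≟_ (≡-dec _≟_ _≟_)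

  Equidistant : List (Vertex a b c) → Vertex a b c → Vertex a b c → Set
  Equidistant U s s' = All (λ r → dist s r ≡ dist s' r) U

  equidistant⇒≡ : {U : List (Vertex a b c)} {s s' : Vertex a b c} →
                  Resolving U → Equidistant U s s' → s ≡ s'
  equidistant⇒≡ {s = s} {s'} resolving eq =
    decidable-stable (s ≟ᵛ s') (λ s≢s' → Any¬⇒¬All (resolving s s' s≢s') eq)

module _ {A : Set} where

  sum-map-+ : (f g : A → ℕ) (xs : List A) →
              sum (map (λ x → f x + g x) xs) ≡ sum (map f xs) + sum (map g xs)
  sum-map-+ f g []       = refl
  sum-map-+ f g (x ∷ xs) =
    trans (cong (f x + g x +_) (sum-map-+ f g xs)) (interchange +-commutativeSemigroup (f x) (g x) _ _)

  sum-map-mono-≤ : {f g : A → ℕ} → (∀ x → f x ≤ g x) → (xs : List A) →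
                   sum (map f xs) ≤ sum (map g xs)
  sum-map-mono-≤ f≤g []       = z≤n
  sum-map-mono-≤ f≤g (x ∷ xs) = +-mono-≤ (f≤g x) (sum-map-mono-≤ f≤g xs)

  sum-map-1 : (xs : List A) → sum (map (λ _ → 1) xs) ≡ length xs
  sum-map-1 []       = refl
  sum-map-1 (x ∷ xs) = cong suc (sum-map-1 xs)

  sum-map-pos : (f : A → ℕ) (xs : List A) → 1 ≤ sum (map f xs) → ∃[ x ] x ∈ xs × 1 ≤ f x
  sum-map-pos f (x ∷ xs) pos with f x in fx≡
  ... | suc _ = x , here refl , subst (1 ≤_) (sym fx≡) (s≤s z≤n)
  ... | zero with sum-map-pos f xs pos
  ...   | y , y∈xs , fy-pos = y , there y∈xs , fy-pos

  sum-map-zero : {f : A → ℕ} {xs : List A} → All (λ x → f x ≡ 0) xs → sum (map f xs) ≡ 0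
  sum-map-zero []             = refl
  sum-map-zero (fx≡0 ∷ zeros) = cong₂ _+_ fx≡0 (sum-map-zero zeros)

  sum-map-≤1 : {f : A → ℕ} {xs : List A} → Unique xs → (∀ x → f x ≤ 1) →
               (∀ {x y} → x ∈ xs → y ∈ xs → 1 ≤ f x → 1 ≤ f y → x ≡ y) →
               sum (map f xs) ≤ 1
  sum-map-≤1 {xs = []} _ _ _ = z≤n
  sum-map-≤1 {f} {x ∷ xs} (x∉xs ∷ unique) f≤1 atMostOne with n≤1⇒n≡0∨n≡1 (f≤1 x)
  ... | inj₁ fx≡0 =
    subst (λ k → k + sum (map f xs) ≤ 1) (sym fx≡0)
      (sum-map-≤1 unique f≤1 (λ x∈ y∈ → atMostOne (there x∈) (there y∈)))
  ... | inj₂ fx≡1 = ≤-reflexive (cong₂ _+_ fx≡1 (sum-map-zero (All.tabulate others-zero)))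
    where
    others-zero : ∀ {y} → y ∈ xs → f y ≡ 0
    others-zero {y} y∈xs with n≤1⇒n≡0∨n≡1 (f≤1 y)
    ... | inj₁ fy≡0 = fy≡0
    ... | inj₂ fy≡1 = contradiction
      (atMostOne (here refl) (there y∈xs) (≤-reflexive (sym fx≡1)) (≤-reflexive (sym fy≡1)))
      (All.lookup x∉xs y∈xs)

-- Counting the values of a coordinate

δ : {n : ℕ} → Fin n → Fin n → ℕ
δ i j = if does (i ≟ j) then 1 else 0

δ-refl : {n : ℕ} (i : Fin n) → δ i i ≡ 1
δ-refl i rewrite dec-true (i ≟ i) refl = refl

δ-≢ : {n : ℕ} {i j : Fin n} → i ≢ j → δ i j ≡ 0
δ-≢ {i = i} {j} i≢j rewrite dec-false (i ≟ j) i≢j = refl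

sum-map-δ : {n : ℕ} (f : Fin n → ℕ) {vs : List (Fin n)} {x : Fin n} →
            Unique vs → x ∈ vs → sum (map (λ v → f v * δ v x) vs) ≡ f x
sum-map-δ f {x ∷ vs} (x∉vs ∷ _) (here refl) = begin
  f x * δ x x + sum (map (λ v → f v * δ v x) vs)
    ≡⟨ cong₂ _+_ (cong (f x *_) (δ-refl x)) (sum-map-zero others) ⟩
  f x * 1 + 0
    ≡⟨ trans (+-identityʳ _) (*-identityʳ (f x)) ⟩
  f x ∎
  where
  open ≡-Reasoning
  others : All (λ v → f v * δ v x ≡ 0) vs
  others = All.map (λ x≢v → trans (cong (f _ *_) (δ-≢ (≢-sym x≢v))) (*-zeroʳ (f _))) x∉vs
sum-map-δ f {v ∷ _} (v∉vs ∷ unique) (there x∈vs) =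
  cong₂ _+_ (trans (cong (f v *_) (δ-≢ (All.lookup v∉vs x∈vs))) (*-zeroʳ (f v)))
            (sum-map-δ f unique x∈vs)

isZero : ℕ → ℕ
isZero zero    = 1
isZero (suc _) = 0

isOne : ℕ → ℕ
isOne (suc zero) = 1
isOne _          = 0

isZero-≤1 : (k : ℕ) → isZero k ≤ 1
isZero-≤1 zero    = s≤s z≤n
isZero-≤1 (suc _) = z≤n

isZero-pos : (k : ℕ) → 1 ≤ isZero k → k ≡ 0
isZero-pos zero _ = refl

isOne-≤1 : (k : ℕ) → isOne k ≤ 1
isOne-≤1 zero          = z≤n
isOne-≤1 (suc zero)    = s≤s z≤n
isOne-≤1 (suc (suc _)) = z≤n

isOne-*-pos : (k l : ℕ) → 1 ≤ isOne k * isOne l → k ≡ 1 × l ≡ 1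
isOne-*-pos (suc zero) (suc zero) _ = refl , refl
isOne-*-pos (suc zero) zero          ()
isOne-*-pos (suc zero) (suc (suc _)) ()
isOne-*-pos zero          _ ()
isOne-*-pos (suc (suc _)) _ ()

isOne-*-self : (k : ℕ) → isOne k * k ≡ isOne k
isOne-*-self zero          = refl
isOne-*-self (suc zero)    = refl
isOne-*-self (suc (suc _)) = refl

2≤k+isOne+2·isZero : (k : ℕ) → 1 + 1 ≤ k + isOne k + (isZero k + isZero k)
2≤k+isOne+2·isZero zero          = ≤-refl
2≤k+isOne+2·isZero (suc zero)    = ≤-refl
2≤k+isOne+2·isZero (suc (suc k)) = s≤s (s≤s z≤n)

bit-sum≤1+pairs : {x y z : ℕ} → x ≤ 1 → y ≤ 1 → z ≤ 1 → x + y + z ≤ 1 + (x * y + y * z + z * x)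
bit-sum≤1+pairs z≤n       z≤n       z≤n       = z≤n
bit-sum≤1+pairs z≤n       z≤n       (s≤s z≤n) = ≤ᵇ⇒≤ _ _ tt
bit-sum≤1+pairs z≤n       (s≤s z≤n) z≤n       = ≤ᵇ⇒≤ _ _ tt
bit-sum≤1+pairs z≤n       (s≤s z≤n) (s≤s z≤n) = ≤ᵇ⇒≤ _ _ tt
bit-sum≤1+pairs (s≤s z≤n) z≤n       z≤n       = ≤ᵇ⇒≤ _ _ tt
bit-sum≤1+pairs (s≤s z≤n) z≤n       (s≤s z≤n) = ≤ᵇ⇒≤ _ _ tt
bit-sum≤1+pairs (s≤s z≤n) (s≤s z≤n) z≤n       = ≤ᵇ⇒≤ _ _ tt
bit-sum≤1+pairs (s≤s z≤n) (s≤s z≤n) (s≤s z≤n) = ≤ᵇ⇒≤ _ _ tt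

module _ {n : ℕ} where

  occurrences : Fin n → List (Fin n) → ℕ
  occurrences v xs = sum (map (δ v) xs)

  unusedCount : List (Fin n) → ℕ
  unusedCount xs = sum (map (λ v → isZero (occurrences v xs)) (allFin n))

  lonely : List (Fin n) → Fin n → ℕ
  lonely xs v = isOne (occurrences v xs)

  lonely-≤1 : (xs : List (Fin n)) (v : Fin n) → lonely xs v ≤ 1
  lonely-≤1 xs v = isOne-≤1 (occurrences v xs)

  sum-occurrences : (f : Fin n → ℕ) (xs : List (Fin n)) →
                    sum (map (λ v → f v * occurrences v xs) (allFin n)) ≡ sum (map f xs)
  sum-occurrences f [] = sum-map-zero (All.universal (λ v → *-zeroʳ (f v)) (allFin n))
  sum-occurrences f (x ∷ xs) = begin
    sum (map (λ v → f v * (δ v x + occurrences v xs)) (allFin n))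
      ≡⟨ cong sum (map-cong (λ v → *-distribˡ-+ (f v) (δ v x) _) (allFin n)) ⟩
    sum (map (λ v → f v * δ v x + f v * occurrences v xs) (allFin n))
      ≡⟨ sum-map-+ _ _ (allFin n) ⟩
    sum (map (λ v → f v * δ v x) (allFin n)) + sum (map (λ v → f v * occurrences v xs) (allFin n))
      ≡⟨ cong₂ _+_ (sum-map-δ f (allFin⁺ n) (∈-allFin x)) (sum-occurrences f xs) ⟩
    f x + sum (map f xs) ∎
    where open ≡-Reasoning

  column-bound : (xs : List (Fin n)) →
                 n + n ≤ length xs + sum (map (lonely xs) xs) + (unusedCount xs + unusedCount xs)
  column-bound xs = begin
    n + n
      ≡⟨ sym (cong₂ _+_ all≡n all≡n) ⟩
    sum (map (λ _ → 1) (allFin n)) + sum (map (λ _ → 1) (allFin n))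
      ≡⟨ sum-map-+ _ _ (allFin n) ⟨
    sum (map (λ _ → 1 + 1) (allFin n))
      ≤⟨ sum-map-mono-≤ (λ v → 2≤k+isOne+2·isZero (occ v)) (allFin n) ⟩
    sum (map (λ v → occ v + isOne (occ v) + (isZero (occ v) + isZero (occ v))) (allFin n))
      ≡⟨ trans (sum-map-+ _ _ (allFin n))
               (cong₂ _+_ (sum-map-+ _ _ (allFin n)) (sum-map-+ _ _ (allFin n))) ⟩
    sum (map occ (allFin n)) + sum (map (λ v → isOne (occ v)) (allFin n))
      + (unusedCount xs + unusedCount xs)
      ≡⟨ cong (_+ (unusedCount xs + unusedCount xs)) (cong₂ _+_ total lonelies) ⟩
    length xs + sum (map (lonely xs) xs) + (unusedCount xs + unusedCount xs) ∎
    where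
    open ≤-Reasoning
    occ : Fin n → ℕ
    occ v = occurrences v xs
    all≡n : sum (map (λ _ → 1) (allFin n)) ≡ n
    all≡n = trans (sum-map-1 (allFin n)) (length-tabulate id)
    total : sum (map occ (allFin n)) ≡ length xs
    total = trans (cong sum (map-cong (λ v → sym (*-identityˡ (occ v))) (allFin n)))
                  (trans (sum-occurrences (λ _ → 1) xs) (sum-map-1 xs))
    lonelies : sum (map (λ v → isOne (occ v)) (allFin n)) ≡ sum (map (lonely xs) xs)
    lonelies = trans (cong sum (map-cong (λ v → sym (isOne-*-self (occ v))) (allFin n)))
                     (sum-occurrences (lonely xs) xs)

module _ {A : Set} {n : ℕ} (π : A → Fin n) where

  occurrences-∈ : {U : List A} {r : A} → r ∈ U → 1 ≤ occurrences (π r) (map π U)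
  occurrences-∈ {h ∷ U} (here refl) =
    subst (λ k → 1 ≤ k + occurrences (π h) (map π U)) (sym (δ-refl (π h))) (s≤s z≤n)
  occurrences-∈ {h ∷ U} (there r∈U) = ≤-trans (occurrences-∈ r∈U) (m≤n+m _ _)

  unused-∉ : {U : List A} {v : Fin n} {r : A} → occurrences v (map π U) ≡ 0 → r ∈ U → v ≢ π r
  unused-∉ none r∈U refl = contradiction (subst (1 ≤_) none (occurrences-∈ r∈U)) λ ()

  lonely-∈ : {U : List A} {q r : A} → occurrences (π q) (map π U) ≡ 1 →
             q ∈ U → r ∈ U → π q ≡ π r → q ≡ r
  lonely-∈ {h ∷ U} _ (here refl) (here refl) _ = refl
  lonely-∈ {h ∷ U} once (here refl) (there r∈U) h≡r = contradiction h≡r (unused-∉ rest-unused r∈U)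
    where
    rest-unused : occurrences (π h) (map π U) ≡ 0
    rest-unused = suc-injective (trans (cong (_+ occurrences (π h) (map π U)) (sym (δ-refl (π h)))) once)
  -- Matching on π q ≟ π h also evaluates δ (π q) (π h) in the type of once.
  lonely-∈ {h ∷ U} {q} once (there q∈U) r∈ q≡r with π q ≟ π h
  ... | yes _    = contradiction refl (unused-∉ (suc-injective once) q∈U)
  ... | no q≢h with r∈
  ...   | here refl = contradiction q≡r q≢h
  ...   | there r∈U = lonely-∈ once q∈U r∈U q≡r

  lonelyIn : List A → A → ℕ
  lonelyIn U q = lonely (map π U) (π q)

  lonelyIn-≤1 : (U : List A) (q : A) → lonelyIn U q ≤ 1
  lonelyIn-≤1 U q = lonely-≤1 (map π U) (π q)

  lonelyCount : List A → ℕ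
  lonelyCount U = sum (map (lonelyIn U) U)

  coordinate-bound : (U : List A) →
    n + n ≤ length U + lonelyCount U + (unusedCount (map π U) + unusedCount (map π U))
  coordinate-bound U =
    subst₂ (λ l s → n + n ≤ l + s + (unusedCount (map π U) + unusedCount (map π U)))
      (length-map π U) (cong sum (sym (map-∘ U))) (column-bound (map π U))

module _ {A : Set} {m n : ℕ} where

  doublyLonely : (A → Fin m) → (A → Fin n) → List A → ℕ
  doublyLonely π π' U = sum (map (λ q → lonelyIn π U q * lonelyIn π' U q) U)

  pairCount : (A → Fin m) → (A → Fin n) → List A → ℕ
  pairCount π π' U = doublyLonely π π' U + unusedCount (map π U) + unusedCount (map π' U)

pairCount-map : {A B : Set} {m n : ℕ} (π : A → Fin m) (π' : A → Fin n) (f : B → A) (U : List B) →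
                pairCount π π' (map f U) ≡ pairCount (π ∘ f) (π' ∘ f) U
pairCount-map π π' f U
  rewrite sym (map-∘ {g = π} {f = f} U) | sym (map-∘ {g = π'} {f = f} U) =
  cong (λ t → t + _ + _) (cong sum (sym (map-∘ U)))

-- The lower bound

π₁ : {a b c : ℕ} → Vertex a b c → Fin a
π₁ = proj₁

π₂ : {a b c : ℕ} → Vertex a b c → Fin b
π₂ = proj₁ ∘ proj₂

π₃ : {a b c : ℕ} → Vertex a b c → Fin c
π₃ = proj₂ ∘ proj₂

rotate : {a b c : ℕ} → Vertex a b c → Vertex b c a
rotate (x , y , z) = (y , z , x)

dist-rotate : {a b c : ℕ} (s r : Vertex a b c) → dist (rotate s) (rotate r) ≡ dist s r
dist-rotate (x , y , z) (u , v , w) =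
  sym (trans (+-assoc (diff x u) (diff y v) (diff z w)) (+-comm (diff x u) _))

module _ {a b c : ℕ} where

  rotate-unique : {U : List (Vertex a b c)} → Unique U → Unique (map rotate U)
  rotate-unique = Unique.map⁺ (cong (rotate ∘ rotate))

  rotate-resolving : {U : List (Vertex a b c)} → Resolving U → Resolving (map rotate U)
  rotate-resolving resolving s s' s≢s' =
    Any.map⁺ (Any.map (λ {q} d≢d' d≡d' →
                         d≢d' (trans (sym (dist-rotate t q)) (trans d≡d' (dist-rotate t' q))))
                       (resolving t t' (s≢s' ∘ cong rotate)))
    where
    t  = rotate (rotate s)
    t' = rotate (rotate s')

  Coupled : List (Vertex a b c) → Fin a → Fin b → Set
  Coupled U x y = ∀ {r} → r ∈ U → (x ≡ π₁ r → y ≡ π₂ r) × (y ≡ π₂ r → x ≡ π₁ r)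

  -- Coupling makes (x , v , z) and (u , y , z) equidistant from every point of U.
  coupled-≡ : {U : List (Vertex a b c)} {x u : Fin a} {y v : Fin b} → Fin c → Resolving U →
              Coupled U x y → Coupled U u v → x ≡ u
  coupled-≡ {U} {x} {u} {y} {v} z resolving xy uv =
    cong π₁ (equidistant⇒≡ {s = x , v , z} {u , y , z} resolving (All.tabulate swapped))
    where
    swapped : ∀ {r} → r ∈ U → dist (x , v , z) r ≡ dist (u , y , z) r
    swapped {r} r∈U = begin
      diff x (π₁ r) + diff v (π₂ r) + diff z (π₃ r)
        ≡⟨ cong₂ (λ d e → d + e + diff z (π₃ r)) (diff-cong (proj₁ (xy r∈U)) (proj₂ (xy r∈U)))
                                                  (diff-cong (proj₂ (uv r∈U)) (proj₁ (uv r∈U))) ⟩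
      diff y (π₂ r) + diff u (π₁ r) + diff z (π₃ r)
        ≡⟨ cong (_+ diff z (π₃ r)) (+-comm (diff y (π₂ r)) _) ⟩
      diff u (π₁ r) + diff y (π₂ r) + diff z (π₃ r) ∎
      where open ≡-Reasoning

  unused-≤1 : {U : List (Vertex a b c)} → Vertex a b c → Resolving U → unusedCount (map π₁ U) ≤ 1
  unused-≤1 {U} (_ , y , z) resolving =
    sum-map-≤1 (allFin⁺ a) (λ v → isZero-≤1 _) λ _ _ x-unused x'-unused →
      cong π₁ (equidistant⇒≡ resolving (All.tabulate λ {r} r∈U →
        cong (λ d → d + diff y (π₂ r) + diff z (π₃ r))
          (trans (diff-≢ (unused-∉ π₁ (isZero-pos _ x-unused) r∈U))
                 (sym (diff-≢ (unused-∉ π₁ (isZero-pos _ x'-unused) r∈U))))))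

pair-count-arith : {t z z' : ℕ} → t ≤ 1 → z ≤ 1 → z' ≤ 1 → (1 ≤ z → 1 ≤ z' → t ≡ 0) →
                   t + z + z' ≤ 2
pair-count-arith z≤n       z≤1       z'≤1      _   = +-mono-≤ z≤1 z'≤1
pair-count-arith (s≤s z≤n) z≤n       z'≤1      _   = s≤s z'≤1
pair-count-arith (s≤s z≤n) (s≤s z≤n) z≤n       _   = ≤-refl
pair-count-arith (s≤s z≤n) (s≤s z≤n) (s≤s z≤n) t≡0 = contradiction (t≡0 (s≤s z≤n) (s≤s z≤n)) λ ()

pair-bound₁₂ : {a b c : ℕ} {U : List (Vertex a b c)} → Vertex a b c → Unique U → Resolving U →
             pairCount π₁ π₂ U ≤ 2
pair-bound₁₂ {a} {U = U} o@(_ , _ , z) unique resolving =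
  pair-count-arith doubly≤1 (unused-≤1 o resolving) unused₂≤1 unused⇒no-doubly
  where
  unused₂≤1 : unusedCount (map π₂ U) ≤ 1
  unused₂≤1 = subst (_≤ 1) (cong unusedCount (sym (map-∘ {g = π₁} {f = rotate} U)))
                (unused-≤1 (rotate o) (rotate-resolving resolving))

  coupled : ∀ {q} → q ∈ U → 1 ≤ lonelyIn π₁ U q * lonelyIn π₂ U q →
            Coupled U (π₁ q) (π₂ q)
  coupled q∈U doubly r∈U with isOne-*-pos _ _ doubly
  ... | once₁ , once₂ = (λ e → cong π₂ (lonely-∈ π₁ once₁ q∈U r∈U e))
                      , (λ e → cong π₁ (lonely-∈ π₂ once₂ q∈U r∈U e))

  doubly≤1 : doublyLonely π₁ π₂ U ≤ 1
  doubly≤1 = sum-map-≤1 unique (λ q → *-mono-≤ (lonelyIn-≤1 π₁ U q) (lonelyIn-≤1 π₂ U q))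
    λ q∈U p∈U dq dp →
      lonely-∈ π₁ (proj₁ (isOne-*-pos _ _ dq)) q∈U p∈U
        (coupled-≡ z resolving (coupled q∈U dq) (coupled p∈U dp))

  unused⇒no-doubly : 1 ≤ unusedCount (map π₁ U) → 1 ≤ unusedCount (map π₂ U) →
                     doublyLonely π₁ π₂ U ≡ 0
  unused⇒no-doubly some₁ some₂
    with sum-map-pos _ (allFin _) some₁ | sum-map-pos _ (allFin _) some₂
  ... | x , _ , x-unused | y , _ , y-unused = n<1⇒n≡0 (≰⇒> λ some-doubly →
    let q , q∈U , dq = sum-map-pos _ U some-doubly in
    unused-∉ π₁ none₁ q∈U (sym (coupled-≡ z resolving (coupled q∈U dq) never)))
    where
    none₁ = isZero-pos _ x-unused
    none₂ = isZero-pos _ y-unused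
    never : Coupled U x y
    never r∈U = (λ x≡ → contradiction x≡ (unused-∉ π₁ none₁ r∈U))
              , (λ y≡ → contradiction y≡ (unused-∉ π₂ none₂ r∈U))

pair-bound₂₃ : {a b c : ℕ} {U : List (Vertex a b c)} → Vertex a b c → Unique U → Resolving U →
               pairCount π₂ π₃ U ≤ 2
pair-bound₂₃ {U = U} o unique resolving =
  subst (_≤ 2) (pairCount-map π₁ π₂ rotate U)
    (pair-bound₁₂ (rotate o) (rotate-unique unique) (rotate-resolving resolving))

pair-bound₃₁ : {a b c : ℕ} {U : List (Vertex a b c)} → Vertex a b c → Unique U → Resolving U →
               pairCount π₃ π₁ U ≤ 2
pair-bound₃₁ {U = U} o unique resolving =
  subst (_≤ 2) (pairCount-map π₂ π₃ rotate U)
    (pair-bound₂₃ (rotate o) (rotate-unique unique) (rotate-resolving resolving))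

lonely-sum-bound : {a b c : ℕ} (U : List (Vertex a b c)) →
  lonelyCount π₁ U + lonelyCount π₂ U + lonelyCount π₃ U ≤
  length U + (doublyLonely π₁ π₂ U + doublyLonely π₂ π₃ U + doublyLonely π₃ π₁ U)
lonely-sum-bound U = begin
  sum (map ℓ₁ U) + sum (map ℓ₂ U) + sum (map ℓ₃ U)
    ≡⟨ trans (sum-map-+ (λ q → ℓ₁ q + ℓ₂ q) ℓ₃ U) (cong (_+ sum (map ℓ₃ U)) (sum-map-+ ℓ₁ ℓ₂ U)) ⟨
  sum (map (λ q → ℓ₁ q + ℓ₂ q + ℓ₃ q) U)
    ≤⟨ sum-map-mono-≤ (λ q → bit-sum≤1+pairs (lonelyIn-≤1 π₁ U q) (lonelyIn-≤1 π₂ U q)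
                                             (lonelyIn-≤1 π₃ U q)) U ⟩
  sum (map (λ q → 1 + (ℓ₁ q * ℓ₂ q + ℓ₂ q * ℓ₃ q + ℓ₃ q * ℓ₁ q)) U)
    ≡⟨ sum-map-+ _ _ U ⟩
  sum (map (λ _ → 1) U) + sum (map (λ q → ℓ₁ q * ℓ₂ q + ℓ₂ q * ℓ₃ q + ℓ₃ q * ℓ₁ q) U)
    ≡⟨ cong₂ _+_ (sum-map-1 U)
                 (trans (sum-map-+ _ _ U) (cong (_+ doublyLonely π₃ π₁ U) (sum-map-+ _ _ U))) ⟩
  length U + (doublyLonely π₁ π₂ U + doublyLonely π₂ π₃ U + doublyLonely π₃ π₁ U) ∎
  where
  open ≤-Reasoning
  ℓ₁ = lonelyIn π₁ U
  ℓ₂ = lonelyIn π₂ U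
  ℓ₃ = lonelyIn π₃ U

lower-bound-arith : {n₁ n₂ n₃ L S₁ S₂ S₃ T₁₂ T₂₃ T₃₁ Z₁ Z₂ Z₃ : ℕ} →
  n₁ + n₁ ≤ L + S₁ + (Z₁ + Z₁) → n₂ + n₂ ≤ L + S₂ + (Z₂ + Z₂) → n₃ + n₃ ≤ L + S₃ + (Z₃ + Z₃) →
  S₁ + S₂ + S₃ ≤ L + (T₁₂ + T₂₃ + T₃₁) →
  T₁₂ + Z₁ + Z₂ ≤ 2 → T₂₃ + Z₂ + Z₃ ≤ 2 → T₃₁ + Z₃ + Z₁ ≤ 2 →
  (n₁ + n₂ + n₃) + (n₁ + n₂ + n₃) ≤ 4 * L + 6
lower-bound-arith {n₁} {n₂} {n₃} {L} {S₁} {S₂} {S₃} {T₁₂} {T₂₃} {T₃₁} {Z₁} {Z₂} {Z₃}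
                  col₁ col₂ col₃ lonelies pair₁₂ pair₂₃ pair₃₁ =
  +-cancelʳ-≤ K _ _
    (subst₂ _≤_ (lhs n₁ n₂ n₃ S₁ S₂ S₃ T₁₂ T₂₃ T₃₁ Z₁ Z₂ Z₃) (rhs L S₁ S₂ S₃ T₁₂ T₂₃ T₃₁ Z₁ Z₂ Z₃)
      (+-mono-≤ (+-mono-≤ (+-mono-≤ (+-mono-≤ (+-mono-≤ (+-mono-≤ col₁ col₂) col₃) lonelies)
        pair₁₂) pair₂₃) pair₃₁))
  where
  K = S₁ + S₂ + S₃ + (T₁₂ + T₂₃ + T₃₁) + (Z₁ + Z₂ + Z₃ + (Z₁ + Z₂ + Z₃))
  lhs : ∀ n₁ n₂ n₃ S₁ S₂ S₃ T₁₂ T₂₃ T₃₁ Z₁ Z₂ Z₃ →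
        n₁ + n₁ + (n₂ + n₂) + (n₃ + n₃) + (S₁ + S₂ + S₃)
          + (T₁₂ + Z₁ + Z₂) + (T₂₃ + Z₂ + Z₃) + (T₃₁ + Z₃ + Z₁)
        ≡ (n₁ + n₂ + n₃) + (n₁ + n₂ + n₃)
          + (S₁ + S₂ + S₃ + (T₁₂ + T₂₃ + T₃₁) + (Z₁ + Z₂ + Z₃ + (Z₁ + Z₂ + Z₃)))
  lhs = solve-∀
  rhs : ∀ L S₁ S₂ S₃ T₁₂ T₂₃ T₃₁ Z₁ Z₂ Z₃ →
        L + S₁ + (Z₁ + Z₁) + (L + S₂ + (Z₂ + Z₂)) + (L + S₃ + (Z₃ + Z₃))
          + (L + (T₁₂ + T₂₃ + T₃₁)) + 2 + 2 + 2
        ≡ 4 * L + 6 + (S₁ + S₂ + S₃ + (T₁₂ + T₂₃ + T₃₁) + (Z₁ + Z₂ + Z₃ + (Z₁ + Z₂ + Z₃)))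
  rhs = solve-∀

lower-bound : {a b c : ℕ} → Vertex a b c → (U : List (Vertex a b c)) → Unique U → Resolving U →
              (a + b + c) + (a + b + c) ≤ 4 * length U + 6
lower-bound {a} {b} {c} o U unique resolving =
  lower-bound-arith {a} {b} {c} {length U} {S₁} {S₂} {S₃} {T₁₂} {T₂₃} {T₃₁} {Z₁} {Z₂} {Z₃}
    (coordinate-bound π₁ U) (coordinate-bound π₂ U) (coordinate-bound π₃ U)
    (lonely-sum-bound U)
    (pair-bound₁₂ o unique resolving) (pair-bound₂₃ o unique resolving)
    (pair-bound₃₁ o unique resolving)
  where
  S₁ = lonelyCount π₁ U
  S₂ = lonelyCount π₂ U
  S₃ = lonelyCount π₃ U
  T₁₂ = doublyLonely π₁ π₂ U
  T₂₃ = doublyLonely π₂ π₃ U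
  T₃₁ = doublyLonely π₃ π₁ U
  Z₁ = unusedCount (map π₁ U)
  Z₂ = unusedCount (map π₂ U)
  Z₃ = unusedCount (map π₃ U)

-- Partial vertices and block-diagonal unions

-- A partial vertex of a block: nothing stands for a coordinate lying outside the block, so
-- it differs from the corresponding coordinate of every point of the block.
PVertex : ℕ → ℕ → ℕ → Set
PVertex a b c = Maybe (Fin a) × Maybe (Fin b) × Maybe (Fin c)

mdiff : {n : ℕ} → Maybe (Fin n) → Fin n → ℕ
mdiff nothing  _ = 1
mdiff (just i) j = diff i j

pdist : {a b c : ℕ} → PVertex a b c → Vertex a b c → ℕ
pdist (x , y , z) (u , v , w) = mdiff x u + mdiff y v + mdiff z w

PEquidistant : {a b c : ℕ} → List (Vertex a b c) → PVertex a b c → PVertex a b c → Set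
PEquidistant Q σ τ = All (λ q → pdist σ q ≡ pdist τ q) Q

Support : Set
Support = Bool × Bool × Bool

support : {a b c : ℕ} → PVertex a b c → Support
support (x , y , z) = is-just x , is-just y , is-just z

ResolvesPartial : {a b c : ℕ} → List (Vertex a b c) → Set
ResolvesPartial {a} {b} {c} Q =
  (σ τ : PVertex a b c) → support σ ≡ support τ → PEquidistant Q σ τ → σ ≡ τ

Separates₁₂ : {a b c : ℕ} → List (Vertex a b c) → Set
Separates₁₂ {a} {b} {c} Q =
  (x : Fin a) (y : Fin b) → ¬ PEquidistant Q (just x , nothing , nothing) (nothing , just y , nothing)

Separates₁₃ : {a b c : ℕ} → List (Vertex a b c) → Set
Separates₁₃ {a} {b} {c} Q =
  (x : Fin a) (z : Fin c) → ¬ PEquidistant Q (just x , nothing , nothing) (nothing , nothing , just z)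

full : {a b c : ℕ} → Vertex a b c → PVertex a b c
full (x , y , z) = just x , just y , just z

resolvesPartial⇒resolving : {a b c : ℕ} {U : List (Vertex a b c)} → ResolvesPartial U → Resolving U
resolvesPartial⇒resolving {U = U} resolvesPartial s s' s≢s' =
  ¬All⇒Any¬ (λ q → dist s q ℕ.≟ dist s' q) U λ equidistant →
    s≢s' (full-injective (resolvesPartial (full s) (full s') refl equidistant))
  where
  full-injective : {t t' : Vertex _ _ _} → full t ≡ full t' → t ≡ t'
  full-injective {_ , _ , _} {_ , _ , _} refl = refl

↑ˡ≢↑ʳ : (k : ℕ) {n : ℕ} (i : Fin k) (j : Fin n) → i ↑ˡ n ≢ k ↑ʳ j
↑ˡ≢↑ʳ k {n} i j eq with trans (sym (splitAt-↑ˡ k i n)) (trans (cong (splitAt k) eq) (splitAt-↑ʳ k n j))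
... | ()

module _ (k : ℕ) {n : ℕ} where

  data Block : Maybe (Fin (k + n)) → Set where
    outside : Block nothing
    low     : (j : Fin k) → Block (just (j ↑ˡ n))
    high    : (j : Fin n) → Block (just (k ↑ʳ j))

  block : (m : Maybe (Fin (k + n))) → Block m
  block nothing = outside
  block (just i) with splitAt k i in eq
  ... | inj₁ j = subst Block (cong just (splitAt⁻¹-↑ˡ eq)) (low j)
  ... | inj₂ j = subst Block (cong just (splitAt⁻¹-↑ʳ eq)) (high j)

  lo : Maybe (Fin (k + n)) → Maybe (Fin k)
  lo nothing = nothing
  lo (just i) with splitAt k i
  ... | inj₁ j = just j
  ... | inj₂ _ = nothing

  hi : Maybe (Fin (k + n)) → Maybe (Fin n)
  hi nothing = nothing
  hi (just i) with splitAt k i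
  ... | inj₁ _ = nothing
  ... | inj₂ j = just j

  lo-↑ˡ : (j : Fin k) → lo (just (j ↑ˡ n)) ≡ just j
  lo-↑ˡ j rewrite splitAt-↑ˡ k j n = refl

  lo-↑ʳ : (j : Fin n) → lo (just (k ↑ʳ j)) ≡ nothing
  lo-↑ʳ j rewrite splitAt-↑ʳ k n j = refl

  hi-↑ˡ : (j : Fin k) → hi (just (j ↑ˡ n)) ≡ nothing
  hi-↑ˡ j rewrite splitAt-↑ˡ k j n = refl

  hi-↑ʳ : (j : Fin n) → hi (just (k ↑ʳ j)) ≡ just j
  hi-↑ʳ j rewrite splitAt-↑ʳ k n j = refl

  mdiff-↑ˡ : (m : Maybe (Fin (k + n))) (j : Fin k) → mdiff m (j ↑ˡ n) ≡ mdiff (lo m) j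
  mdiff-↑ˡ m j with block m
  ... | outside = refl
  ... | low i  rewrite lo-↑ˡ i = diff-cong (↑ˡ-injective n i j) (cong (_↑ˡ n))
  ... | high i rewrite lo-↑ʳ i = diff-≢ (↑ˡ≢↑ʳ k j i ∘ sym)

  mdiff-↑ʳ : (m : Maybe (Fin (k + n))) (j : Fin n) → mdiff m (k ↑ʳ j) ≡ mdiff (hi m) j
  mdiff-↑ʳ m j with block m
  ... | outside = refl
  ... | low i  rewrite hi-↑ˡ i = diff-≢ (↑ˡ≢↑ʳ k i j)
  ... | high i rewrite hi-↑ʳ i = diff-cong (↑ʳ-injective k i j) (cong (k ↑ʳ_))

  merge : Maybe (Fin k) → Maybe (Fin n) → Maybe (Fin (k + n))
  merge (just i) _        = just (i ↑ˡ n)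
  merge nothing  (just j) = just (k ↑ʳ j)
  merge nothing  nothing  = nothing

  merge-lo-hi : (m : Maybe (Fin (k + n))) → merge (lo m) (hi m) ≡ m
  merge-lo-hi m with block m
  ... | outside = refl
  ... | low i  rewrite lo-↑ˡ i = refl
  ... | high i rewrite lo-↑ʳ i | hi-↑ʳ i = refl

  lo-hi-injective : {m m' : Maybe (Fin (k + n))} → lo m ≡ lo m' → hi m ≡ hi m' → m ≡ m'
  lo-hi-injective {m} {m'} lo≡ hi≡ =
    trans (sym (merge-lo-hi m)) (trans (cong₂ merge lo≡ hi≡) (merge-lo-hi m'))

  is-just-hi : (m : Maybe (Fin (k + n))) → is-just (hi m) ≡ is-just m ∧ not (is-just (lo m))
  is-just-hi m with block m
  ... | outside = refl
  ... | low i  rewrite lo-↑ˡ i | hi-↑ˡ i = refl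
  ... | high i rewrite lo-↑ʳ i | hi-↑ʳ i = refl

  is-just-lo : (m : Maybe (Fin (k + n))) → is-just (lo m) ≡ true → is-just m ≡ true
  is-just-lo (just _) _ = refl

  is-just-hi-cong : (m m' : Maybe (Fin (k + n))) → is-just m ≡ is-just m' → lo m ≡ lo m' →
                    is-just (hi m) ≡ is-just (hi m')
  is-just-hi-cong m m' present lo≡ =
    trans (is-just-hi m) (trans (cong₂ (λ u v → u ∧ not (is-just v)) present lo≡) (sym (is-just-hi m')))

  hi-absent : (m : Maybe (Fin (k + n))) → is-just (lo m) ≡ true → hi m ≡ nothing
  hi-absent m lo-present with is-just-hi m
  ... | eq rewrite is-just-lo m lo-present | lo-present = is-just-false (hi m) eq
    where
    is-just-false : {A : Set} (x : Maybe A) → is-just x ≡ false → x ≡ nothing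
    is-just-false nothing _ = refl

  hi-present : (m : Maybe (Fin (k + n))) → is-just (lo m) ≡ false → is-just m ≡ true →
               ∃[ j ] hi m ≡ just j
  hi-present m lo-absent present with hi m | is-just-hi m
  ... | just j | _ = j , refl
  ... | nothing | eq rewrite present | lo-absent = contradiction eq λ ()

components : {A B C : Set} {x x' : A} {y y' : B} {z z' : C} →
             (x , y , z) ≡ (x' , y' , z') → x ≡ x' × y ≡ y' × z ≡ z'
components refl = refl , refl , refl

module Union {p q r a b c : ℕ} where

  splitL : PVertex (p + a) (q + b) (r + c) → PVertex p q r
  splitL (x , y , z) = lo p x , lo q y , lo r z

  splitR : PVertex (p + a) (q + b) (r + c) → PVertex a b c
  splitR (x , y , z) = hi p x , hi q y , hi r z

  embedL : Vertex p q r → Vertex (p + a) (q + b) (r + c)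
  embedL (x , y , z) = x ↑ˡ a , y ↑ˡ b , z ↑ˡ c

  embedR : Vertex a b c → Vertex (p + a) (q + b) (r + c)
  embedR (x , y , z) = p ↑ʳ x , q ↑ʳ y , r ↑ʳ z

  _⊕_ : List (Vertex p q r) → List (Vertex a b c) → List (Vertex (p + a) (q + b) (r + c))
  X ⊕ Q = map embedL X ++ map embedR Q

  pdist-embedL : (σ : PVertex (p + a) (q + b) (r + c)) (t : Vertex p q r) →
                 pdist σ (embedL t) ≡ pdist (splitL σ) t
  pdist-embedL (x , y , z) (u , v , w) =
    cong₂ _+_ (cong₂ _+_ (mdiff-↑ˡ p x u) (mdiff-↑ˡ q y v)) (mdiff-↑ˡ r z w)

  pdist-embedR : (σ : PVertex (p + a) (q + b) (r + c)) (t : Vertex a b c) →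
                 pdist σ (embedR t) ≡ pdist (splitR σ) t
  pdist-embedR (x , y , z) (u , v , w) =
    cong₂ _+_ (cong₂ _+_ (mdiff-↑ʳ p x u) (mdiff-↑ʳ q y v)) (mdiff-↑ʳ r z w)

  ⊕-equidistant : {X : List (Vertex p q r)} {Q : List (Vertex a b c)}
                  {σ τ : PVertex (p + a) (q + b) (r + c)} →
                  PEquidistant (X ⊕ Q) σ τ →
                  PEquidistant X (splitL σ) (splitL τ) × PEquidistant Q (splitR σ) (splitR τ)
  ⊕-equidistant {X} {Q} {σ} {τ} equidistant with ++⁻ (map embedL X) equidistant
  ... | onX , onQ =
    All.map (λ {t} e → trans (sym (pdist-embedL σ t)) (trans e (pdist-embedL τ t))) (map⁻ onX) ,
    All.map (λ {t} e → trans (sym (pdist-embedR σ t)) (trans e (pdist-embedR τ t))) (map⁻ onQ)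

  split-injective : {σ τ : PVertex (p + a) (q + b) (r + c)} →
                    splitL σ ≡ splitL τ → splitR σ ≡ splitR τ → σ ≡ τ
  split-injective {x , y , z} {x' , y' , z'} L≡ R≡
    with components L≡ | components R≡
  ... | x-lo , y-lo , z-lo | x-hi , y-hi , z-hi =
    cong₂ _,_ (lo-hi-injective p x-lo x-hi)
      (cong₂ _,_ (lo-hi-injective q y-lo y-hi) (lo-hi-injective r z-lo z-hi))

  support-splitR : {σ τ : PVertex (p + a) (q + b) (r + c)} →
                   support σ ≡ support τ → splitL σ ≡ splitL τ → support (splitR σ) ≡ support (splitR τ)
  support-splitR {x , y , z} {x' , y' , z'} same L≡
    with components same | components L≡
  ... | x~ , y~ , z~ | x-lo , y-lo , z-lo =
    cong₂ _,_ (is-just-hi-cong p x x' x~ x-lo)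
      (cong₂ _,_ (is-just-hi-cong q y y' y~ y-lo) (is-just-hi-cong r z z' z~ z-lo))

  ⊕-unique : {X : List (Vertex p q r)} {Q : List (Vertex a b c)} → Unique X → Unique Q → Unique (X ⊕ Q)
  ⊕-unique uniqueX uniqueQ =
    Unique.++⁺ (Unique.map⁺ embedL-injective uniqueX) (Unique.map⁺ embedR-injective uniqueQ) disjoint
    where
    embedL-injective : {t t' : Vertex p q r} → embedL t ≡ embedL t' → t ≡ t'
    embedL-injective {x , y , z} {x' , y' , z'} e with components e
    ... | ex , ey , ez =
      cong₂ _,_ (↑ˡ-injective a x x' ex) (cong₂ _,_ (↑ˡ-injective b y y' ey) (↑ˡ-injective c z z' ez))
    embedR-injective : {t t' : Vertex a b c} → embedR t ≡ embedR t' → t ≡ t'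
    embedR-injective {x , y , z} {x' , y' , z'} e with components e
    ... | ex , ey , ez =
      cong₂ _,_ (↑ʳ-injective p x x' ex) (cong₂ _,_ (↑ʳ-injective q y y' ey) (↑ʳ-injective r z z' ez))
    disjoint : ∀ {v} → ¬ (v ∈ map embedL _ × v ∈ map embedR _)
    disjoint (inL , inR) with ∈-map⁻ embedL inL | ∈-map⁻ embedR inR
    ... | (x , _ , _) , _ , refl | (x' , _ , _) , _ , e = ↑ˡ≢↑ʳ p x x' (proj₁ (components e))

  ⊕-length : (X : List (Vertex p q r)) (Q : List (Vertex a b c)) → length (X ⊕ Q) ≡ length X + length Q
  ⊕-length X Q = trans (length-++ (map embedL X)) (cong₂ _+_ (length-map embedL X) (length-map embedR Q))

Shaped : {p q r : ℕ} → Support → PVertex p q r → PVertex p q r → Set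
Shaped s σ τ = support σ ≡ (false , true , true) × support τ ≡ s

ConfusesOnly : {p q r : ℕ} → Support → List (Vertex p q r) → Set
ConfusesOnly {p} {q} {r} s X =
  (σ τ : PVertex p q r) → PEquidistant X σ τ → σ ≡ τ ⊎ Shaped s σ τ ⊎ Shaped s τ σ

module _ {p q r a b c : ℕ} where

  open Union {p} {q} {r} {a} {b} {c}

  SeparatesHighParts : Support → List (Vertex a b c) → Set
  SeparatesHighParts s Q = (σ τ : PVertex (p + a) (q + b) (r + c)) → support σ ≡ support τ →
    Shaped s (splitL σ) (splitL τ) → ¬ PEquidistant Q (splitR σ) (splitR τ)

  ⊕-resolvesPartial : {s : Support} {X : List (Vertex p q r)} {Q : List (Vertex a b c)} →
    ConfusesOnly s X → ResolvesPartial Q → SeparatesHighParts s Q → ResolvesPartial (X ⊕ Q)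
  ⊕-resolvesPartial {X = X} {Q} confusesOnly resolvesQ separatesHigh σ τ same equidistant
    with ⊕-equidistant {X} {Q} {σ} {τ} equidistant
  ... | onX , onQ with confusesOnly _ _ onX
  ... | inj₁ L≡ = split-injective L≡ (resolvesQ _ _ (support-splitR same L≡) onQ)
  ... | inj₂ (inj₁ shaped) = contradiction onQ (separatesHigh σ τ same shaped)
  ... | inj₂ (inj₂ shaped) = contradiction (All.map sym onQ) (separatesHigh τ σ (sym same) shaped)

  -- Equal supports force the high parts of σ and τ to be (x₀ , – , –) and (– , y₀ , –).
  separatesHighParts₁₂ : {Q : List (Vertex a b c)} → Separates₁₂ Q →
                         SeparatesHighParts (true , false , true) Q
  separatesHighParts₁₂ separates (x , y , z) (x' , y' , z') same (σL , τL) onQ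
    with components same | components σL | components τL
  ... | x~ , y~ , _ | x-lo , y-lo , z-lo | x'-lo , y'-lo , z'-lo
    with hi-present p x x-lo (trans x~ (is-just-lo p x' x'-lo))
       | hi-present q y' y'-lo (trans (sym y~) (is-just-lo q y y-lo))
  ... | x₀ , x-hi | y₀ , y'-hi =
    separates x₀ y₀ (subst₂ (PEquidistant _)
      (cong₂ _,_ x-hi (cong₂ _,_ (hi-absent q y y-lo) (hi-absent r z z-lo)))
      (cong₂ _,_ (hi-absent p x' x'-lo) (cong₂ _,_ y'-hi (hi-absent r z' z'-lo)))
      onQ)

  separatesHighParts₁₃ : {Q : List (Vertex a b c)} → Separates₁₃ Q →
                         SeparatesHighParts (true , true , false) Q
  separatesHighParts₁₃ separates (x , y , z) (x' , y' , z') same (σL , τL) onQ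
    with components same | components σL | components τL
  ... | x~ , _ , z~ | x-lo , y-lo , z-lo | x'-lo , y'-lo , z'-lo
    with hi-present p x x-lo (trans x~ (is-just-lo p x' x'-lo))
       | hi-present r z' z'-lo (trans (sym z~) (is-just-lo r z z-lo))
  ... | x₀ , x-hi | z₀ , z'-hi =
    separates x₀ z₀ (subst₂ (PEquidistant _)
      (cong₂ _,_ x-hi (cong₂ _,_ (hi-absent q y y-lo) (hi-absent r z z-lo)))
      (cong₂ _,_ (hi-absent p x' x'-lo) (cong₂ _,_ (hi-absent q y' y'-lo) z'-hi))
      onQ)

  -- Low parts with at most one coordinate are never shaped, so X confuses them only if they
  -- coincide, and then both are empty.
  ⊕-separates₁₂ : {s : Support} {X : List (Vertex p q r)} {Q : List (Vertex a b c)} →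
                  ConfusesOnly s X → Separates₁₂ Q → Separates₁₂ (X ⊕ Q)
  ⊕-separates₁₂ {X = X} {Q} confusesOnly separates x y equidistant
    with ⊕-equidistant {X} {Q} {just x , nothing , nothing} {nothing , just y , nothing} equidistant
  ... | onX , onQ
    with confusesOnly (lo p (just x) , nothing , nothing) (nothing , lo q (just y) , nothing) onX
  ... | inj₂ (inj₁ (σL , _)) = contradiction (proj₁ (proj₂ (components σL))) λ ()
  ... | inj₂ (inj₂ (τL , _)) = contradiction (proj₂ (proj₂ (components τL))) λ ()
  ... | inj₁ L≡ with components L≡
  ...   | x-lo , y-lo , _
    with hi-present p (just x) (cong is-just x-lo) refl
       | hi-present q (just y) (cong is-just (sym y-lo)) refl
  ...   | x₀ , x-hi | y₀ , y-hi =
    separates x₀ y₀ (subst₂ (PEquidistant _)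
      (cong (_, nothing , nothing) x-hi) (cong (λ v → nothing , v , nothing) y-hi) onQ)

  ⊕-separates₁₃ : {s : Support} {X : List (Vertex p q r)} {Q : List (Vertex a b c)} →
                  ConfusesOnly s X → Separates₁₃ Q → Separates₁₃ (X ⊕ Q)
  ⊕-separates₁₃ {X = X} {Q} confusesOnly separates x z equidistant
    with ⊕-equidistant {X} {Q} {just x , nothing , nothing} {nothing , nothing , just z} equidistant
  ... | onX , onQ
    with confusesOnly (lo p (just x) , nothing , nothing) (nothing , nothing , lo r (just z)) onX
  ... | inj₂ (inj₁ (σL , _)) = contradiction (proj₁ (proj₂ (components σL))) λ ()
  ... | inj₂ (inj₂ (τL , _)) = contradiction (proj₁ (proj₂ (components τL))) λ ()
  ... | inj₁ L≡ with components L≡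
  ...   | x-lo , _ , z-lo
    with hi-present p (just x) (cong is-just x-lo) refl
       | hi-present r (just z) (cong is-just (sym z-lo)) refl
  ...   | x₀ , x-hi | z₀ , z-hi =
    separates x₀ z₀ (subst₂ (PEquidistant _)
      (cong (_, nothing , nothing) x-hi) (cong (λ v → nothing , nothing , v) z-hi) onQ)

-- Checking explicit point sets by computation

unique-map⇒injective : {A B : Set} (f : A → B) {xs : List A} {x y : A} →
                       Unique (map f xs) → x ∈ xs → y ∈ xs → f x ≡ f y → x ≡ y
unique-map⇒injective f unique = go (AllPairs.map⁻ unique)
  where
  go : ∀ {xs x y} → AllPairs (λ u v → f u ≢ f v) xs → x ∈ xs → y ∈ xs → f x ≡ f y → x ≡ y
  go _                   (here refl) (here refl) _  = refl
  go (fx≢ ∷ _) (here refl) (there y∈)  fx≡fy = contradiction fx≡fy (All.lookup fx≢ y∈)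
  go (fy≢ ∷ _) (there x∈)  (here refl) fx≡fy = contradiction (sym fx≡fy) (All.lookup fy≢ x∈)
  go (_ ∷ ps)  (there x∈)  (there y∈)  fx≡fy = go ps x∈ y∈ fx≡fy

supportCode : Support → ℕ
supportCode (u , v , w) = bit u + 2 * bit v + 4 * bit w
  where
  bit : Bool → ℕ
  bit true  = 1
  bit false = 0

module _ {a b c : ℕ} where

  allPVertices : List (PVertex a b c)
  allPVertices = cartesianProduct (options a) (cartesianProduct (options b) (options c))
    where
    options : (n : ℕ) → List (Maybe (Fin n))
    options n = nothing ∷ map just (allFin n)

  ∈-allPVertices : (σ : PVertex a b c) → σ ∈ allPVertices
  ∈-allPVertices (x , y , z) = ∈-cartesianProduct⁺ (option x) (∈-cartesianProduct⁺ (option y) (option z))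
    where
    option : {n : ℕ} (m : Maybe (Fin n)) → m ∈ nothing ∷ map just (allFin n)
    option nothing  = here refl
    option (just i) = there (∈-map⁺ just (∈-allFin i))

  all-PVertex? : {P : PVertex a b c → Set} → Decidable P → Dec (∀ σ → P σ)
  all-PVertex? P? = map′ (λ all σ → All.lookup all (∈-allPVertices σ)) (λ f → All.universal f _)
                         (All.all? P? allPVertices)

  _≟ₚ_ : DecidableEquality (PVertex a b c)
  _≟ₚ_ = ≡-dec (Maybe.≡-dec _≟_) (≡-dec (Maybe.≡-dec _≟_) (Maybe.≡-dec _≟_))

  _≟ₛ_ : DecidableEquality Support
  _≟ₛ_ = ≡-dec Bool._≟_ (≡-dec Bool._≟_ Bool._≟_)

  pequidistant? : (Q : List (Vertex a b c)) (σ τ : PVertex a b c) → Dec (PEquidistant Q σ τ)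
  pequidistant? Q σ τ = All.all? (λ q → pdist σ q ℕ.≟ pdist τ q) Q

  confusesOnly? : (s : Support) (X : List (Vertex a b c)) → Dec (ConfusesOnly s X)
  confusesOnly? s X = all-PVertex? λ σ → all-PVertex? λ τ →
    pequidistant? X σ τ →-dec (σ ≟ₚ τ ⊎-dec (shaped? σ τ ⊎-dec shaped? τ σ))
    where
    shaped? : (σ τ : PVertex a b c) → Dec (Shaped s σ τ)
    shaped? σ τ = (support σ ≟ₛ (false , true , true)) ×-dec (support τ ≟ₛ s)

  separates₁₂? : (Q : List (Vertex a b c)) → Dec (Separates₁₂ Q)
  separates₁₂? Q = Fin.all? λ x → Fin.all? λ y →
    ¬? (pequidistant? Q (just x , nothing , nothing) (nothing , just y , nothing))

  separates₁₃? : (Q : List (Vertex a b c)) → Dec (Separates₁₃ Q)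
  separates₁₃? Q = Fin.all? λ x → Fin.all? λ z →
    ¬? (pequidistant? Q (just x , nothing , nothing) (nothing , nothing , just z))

  -- Soundness only needs the profile to be a function of the support and the distances; base 4
  -- (distances are at most 3) makes it injective, so that the check succeeds.
  profile : List (Vertex a b c) → PVertex a b c → ℕ
  profile Q σ = foldr (λ d code → d + 4 * code) (supportCode (support σ)) (map (pdist σ) Q)

  ProfilesDistinct : List (Vertex a b c) → Set
  ProfilesDistinct Q = True (unique? ℕ._≟_ (map (profile Q) allPVertices))

  profilesDistinct⇒resolvesPartial : (Q : List (Vertex a b c)) → ProfilesDistinct Q → ResolvesPartial Q
  profilesDistinct⇒resolvesPartial Q distinct σ τ same equidistant =
    unique-map⇒injective (profile Q) (toWitness distinct) (∈-allPVertices σ) (∈-allPVertices τ)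
      (cong₂ (λ s ds → foldr (λ d code → d + 4 * code) (supportCode s) ds)
             same (map-cong-local equidistant))

-- The constructions

record Construction (a b c : ℕ) : Set where
  field
    points          : List (Vertex a b c)
    unique          : Unique points
    size            : 1 + length points ≡ a + a
    resolvesPartial : ResolvesPartial points
    separates₁₂     : Separates₁₂ points

open Construction

Construction⁺ : ℕ → ℕ → ℕ → Set
Construction⁺ a b c = Σ[ K ∈ Construction a b c ] Separates₁₃ (points K)

gadget₂₂₄ : List (Vertex 2 2 4)
gadget₂₂₄ = (# 0 , # 0 , # 0) ∷ (# 0 , # 1 , # 1) ∷ (# 1 , # 0 , # 2) ∷ (# 1 , # 1 , # 3) ∷ []

gadget₂₄₂ : List (Vertex 2 4 2)
gadget₂₄₂ = (# 0 , # 0 , # 0) ∷ (# 0 , # 1 , # 1) ∷ (# 1 , # 2 , # 0) ∷ (# 1 , # 3 , # 1) ∷ []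

gadget₂₂₄-confusesOnly : ConfusesOnly (true , false , true) gadget₂₂₄
gadget₂₂₄-confusesOnly = from-yes (confusesOnly? (true , false , true) gadget₂₂₄)

gadget₂₄₂-confusesOnly : ConfusesOnly (true , true , false) gadget₂₄₂
gadget₂₄₂-confusesOnly = from-yes (confusesOnly? (true , true , false) gadget₂₄₂)

size-step : {a L : ℕ} → 1 + L ≡ a + a → 1 + (4 + L) ≡ (2 + a) + (2 + a)
size-step {a} {L} e = trans (cong (4 +_) e) (shift a)
  where
  shift : ∀ a → 4 + (a + a) ≡ (2 + a) + (2 + a)
  shift = solve-∀

module _ {a b c : ℕ} where

  extend₂₂₄ : Construction a b c → Construction (2 + a) (2 + b) (4 + c)
  extend₂₂₄ K = record
    { points          = gadget₂₂₄ ⊕ points K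
    ; unique          = ⊕-unique (from-yes (unique? _≟ᵛ_ gadget₂₂₄)) (unique K)
    ; size            = trans (cong suc (⊕-length gadget₂₂₄ (points K))) (size-step (size K))
    ; resolvesPartial = ⊕-resolvesPartial gadget₂₂₄-confusesOnly (resolvesPartial K)
                          (separatesHighParts₁₂ (separates₁₂ K))
    ; separates₁₂     = ⊕-separates₁₂ gadget₂₂₄-confusesOnly (separates₁₂ K)
    }
    where open Union {2} {2} {4} {a} {b} {c}

  extend₂₄₂ : (K : Construction a b c) → Separates₁₃ (points K) → Construction (2 + a) (4 + b) (2 + c)
  extend₂₄₂ K separates₁₃ = record
    { points          = gadget₂₄₂ ⊕ points K
    ; unique          = ⊕-unique (from-yes (unique? _≟ᵛ_ gadget₂₄₂)) (unique K)
    ; size            = trans (cong suc (⊕-length gadget₂₄₂ (points K))) (size-step (size K))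
    ; resolvesPartial = ⊕-resolvesPartial gadget₂₄₂-confusesOnly (resolvesPartial K)
                          (separatesHighParts₁₃ separates₁₃)
    ; separates₁₂     = ⊕-separates₁₂ gadget₂₄₂-confusesOnly (separates₁₂ K)
    }
    where open Union {2} {4} {2} {a} {b} {c}

  extend₂₂₄⁺ : Construction⁺ a b c → Construction⁺ (2 + a) (2 + b) (4 + c)
  extend₂₂₄⁺ (K , separates₁₃) =
    extend₂₂₄ K , ⊕-separates₁₃ gadget₂₂₄-confusesOnly separates₁₃
    where open Union {2} {2} {4} {a} {b} {c}

  extend₂₄₂⁺ : Construction⁺ a b c → Construction⁺ (2 + a) (4 + b) (2 + c)
  extend₂₄₂⁺ (K , separates₁₃) =
    extend₂₄₂ K separates₁₃ , ⊕-separates₁₃ gadget₂₄₂-confusesOnly separates₁₃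
    where open Union {2} {4} {2} {a} {b} {c}


  checked : (U : List (Vertex a b c)) → 1 + length U ≡ a + a → True (unique? _≟ᵛ_ U) →
            ProfilesDistinct U → True (separates₁₂? U) → Construction a b c
  checked U size unique resolves separates₁₂ = record
    { points          = U
    ; unique          = toWitness unique
    ; size            = size
    ; resolvesPartial = profilesDistinct⇒resolvesPartial U resolves
    ; separates₁₂     = toWitness separates₁₂
    }

  checked⁺ : (U : List (Vertex a b c)) → 1 + length U ≡ a + a → True (unique? _≟ᵛ_ U) →
             ProfilesDistinct U → True (separates₁₂? U) → True (separates₁₃? U) → Construction⁺ a b c
  checked⁺ U size unique resolves separates₁₂ separates₁₃ =
    checked U size unique resolves separates₁₂ , toWitness separates₁₃

base₁₁₂ : List (Vertex 1 1 2)
base₁₁₂ = (zero , zero , zero) ∷ []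

base₂₂₄ : Construction 2 2 4
base₂₂₄ = checked ((# 0 , # 0 , # 0) ∷ (# 1 , # 0 , # 1) ∷ (# 1 , # 1 , # 2) ∷ []) refl _ _ _

base₃₃₆ : Construction 3 3 6
base₃₃₆ = checked
  ((# 0 , # 0 , # 0) ∷ (# 1 , # 0 , # 1) ∷ (# 1 , # 1 , # 2) ∷ (# 2 , # 1 , # 3) ∷ (# 2 , # 2 , # 4) ∷ [])
  refl _ _ _

base₂₃₃ : Construction⁺ 2 3 3
base₂₃₃ = checked⁺ ((# 0 , # 0 , # 1) ∷ (# 1 , # 0 , # 0) ∷ (# 1 , # 2 , # 1) ∷ []) refl _ _ _ _

base₃₄₅ : Construction⁺ 3 4 5
base₃₄₅ = checked⁺
  ((# 0 , # 0 , # 4) ∷ (# 0 , # 1 , # 3) ∷ (# 1 , # 2 , # 4) ∷ (# 2 , # 1 , # 2) ∷ (# 2 , # 2 , # 0) ∷ [])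
  refl _ _ _ _

base₅₇₈ : Construction⁺ 5 7 8
base₅₇₈ = checked⁺
  ((# 0 , # 2 , # 3) ∷ (# 0 , # 4 , # 7) ∷ (# 1 , # 2 , # 1) ∷ (# 1 , # 4 , # 2) ∷ (# 2 , # 0 , # 0) ∷
   (# 2 , # 5 , # 5) ∷ (# 3 , # 0 , # 4) ∷ (# 4 , # 1 , # 4) ∷ (# 4 , # 6 , # 5) ∷ [])
  refl _ _ _ _

base₆₈₁₀ : Construction⁺ 6 8 10
base₆₈₁₀ = checked⁺
  ((# 0 , # 1 , # 4) ∷ (# 0 , # 2 , # 8) ∷ (# 1 , # 3 , # 6) ∷ (# 1 , # 7 , # 9) ∷ (# 2 , # 3 , # 3) ∷
   (# 2 , # 4 , # 2) ∷ (# 3 , # 5 , # 8) ∷ (# 3 , # 6 , # 1) ∷ (# 4 , # 4 , # 0) ∷ (# 4 , # 7 , # 7) ∷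
   (# 5 , # 1 , # 1) ∷ [])
  refl _ _ _ _

cast : {F : ℕ → ℕ → ℕ → Set} {a b c a' b' c' : ℕ} → a ≡ a' → b ≡ b' → c ≡ c' →
       F a b c → F a' b' c'
cast refl refl refl x = x

family₀ : (d : ℕ) → Construction (2 + d) (2 + d) (2 * (2 + d))
family₀ 0             = base₂₂₄
family₀ 1             = base₃₃₆
family₀ (suc (suc d)) = cast {Construction} refl refl (double (2 + d)) (extend₂₂₄ (family₀ d))
  where
  double : ∀ n → 4 + 2 * n ≡ 2 * (2 + n)
  double = solve-∀

grow-d : (m d : ℕ) → Construction⁺ (2 * m + d) (3 * m + d) (3 * m + 2 * d) →
         Construction⁺ (2 * m + (2 + d)) (3 * m + (2 + d)) (3 * m + 2 * (2 + d))
grow-d m d K = cast {Construction⁺} (e₁ m d) (e₂ m d) (e₃ m d) (extend₂₂₄⁺ K)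
  where
  e₁ : ∀ m d → 2 + (2 * m + d) ≡ 2 * m + (2 + d)
  e₁ = solve-∀
  e₂ : ∀ m d → 2 + (3 * m + d) ≡ 3 * m + (2 + d)
  e₂ = solve-∀
  e₃ : ∀ m d → 4 + (3 * m + 2 * d) ≡ 3 * m + 2 * (2 + d)
  e₃ = solve-∀

trade-d-for-m : (m d : ℕ) → Construction⁺ (2 * m + (2 + d)) (3 * m + (2 + d)) (3 * m + 2 * (2 + d)) →
                Construction⁺ (2 * (2 + m) + d) (3 * (2 + m) + d) (3 * (2 + m) + 2 * d)
trade-d-for-m m d K = cast {Construction⁺} (e₁ m d) (e₂ m d) (e₃ m d) (extend₂₄₂⁺ K)
  where
  e₁ : ∀ m d → 2 + (2 * m + (2 + d)) ≡ 2 * (2 + m) + d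
  e₁ = solve-∀
  e₂ : ∀ m d → 4 + (3 * m + (2 + d)) ≡ 3 * (2 + m) + d
  e₂ = solve-∀
  e₃ : ∀ m d → 2 + (3 * m + 2 * (2 + d)) ≡ 3 * (2 + m) + 2 * d
  e₃ = solve-∀

family⁺ : (m d : ℕ) → 1 ≤ m → ¬ (m ≡ 2 × d ≡ 0) → Construction⁺ (2 * m + d) (3 * m + d) (3 * m + 2 * d)
family⁺ 1 0                   _ _        = base₂₃₃
family⁺ 1 1                   _ _        = base₃₄₅
family⁺ 1 (suc (suc d))       _ _        = grow-d 1 d (family⁺ 1 d (s≤s z≤n) λ ())
family⁺ 2 0                   _ excluded = contradiction (refl , refl) excluded
family⁺ 2 1                   _ _        = base₅₇₈
family⁺ 2 2                   _ _        = base₆₈₁₀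
family⁺ 2 (suc (suc (suc d))) _ _        = grow-d 2 (suc d) (family⁺ 2 (suc d) (s≤s z≤n) λ ())
family⁺ (suc (suc (suc m))) d _ _        = trade-d-for-m (suc m) d (family⁺ (suc m) (2 + d) (s≤s z≤n) λ ())

ResolvingSet : ℕ → ℕ → ℕ → ℕ → Set
ResolvingSet a b c k = Σ[ U ∈ List (Vertex a b c) ] (Unique U × Resolving U × length U ≡ k)

resolvingSet : {a b c : ℕ} → Construction a b c → ResolvingSet a b c ((a + a) ∸ 1)
resolvingSet K = points K , unique K , resolvesPartial⇒resolving (resolvesPartial K) , cong (_∸ 1) (size K)

upper-bound : (m d : ℕ) → 1 ≤ 2 * m + d → ¬ (m ≡ 2 × d ≡ 0) →
  ResolvingSet (2 * m + d) (3 * m + d) (3 * m + 2 * d) ((2 * m + d) + (2 * m + d) ∸ 1)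
upper-bound 0 0 () _
upper-bound 0 1 _ _ =
  base₁₁₂ , from-yes (unique? _≟ᵛ_ base₁₁₂) ,
  resolvesPartial⇒resolving (profilesDistinct⇒resolvesPartial base₁₁₂ _) , refl
upper-bound 0 (suc (suc d)) _ _ = resolvingSet (family₀ d)
upper-bound (suc m) d _ excluded = resolvingSet (proj₁ (family⁺ (suc m) d (s≤s z≤n) excluded))

parametrise : {a b c : ℕ} → a ≤ b → b ≤ c → 3 * a ≡ b + c →
              ∃[ m ] ∃[ d ] a ≡ 2 * m + d × b ≡ 3 * m + d × c ≡ 3 * m + 2 * d
parametrise {a} a≤b b≤c 3a≡b+c with m≤n⇒∃[o]m+o≡n a≤b | m≤n⇒∃[o]m+o≡n b≤c
... | m , refl | d , refl =
  m , d , a≡ , trans (cong (_+ m) a≡) (e₃ m d) , trans (cong (λ t → t + m + d) a≡) (e₄ m d)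
  where
  e₁ : ∀ a → 3 * a ≡ 2 * a + a
  e₁ = solve-∀
  e₂ : ∀ a m d → a + m + (a + m + d) ≡ 2 * a + (2 * m + d)
  e₂ = solve-∀
  e₃ : ∀ m d → 2 * m + d + m ≡ 3 * m + d
  e₃ = solve-∀
  e₄ : ∀ m d → 2 * m + d + m + d ≡ 3 * m + 2 * d
  e₄ = solve-∀
  a≡ : a ≡ 2 * m + d
  a≡ = +-cancelˡ-≡ (2 * a) a (2 * m + d) (trans (sym (e₁ a)) (trans 3a≡b+c (e₂ a m d)))

4M≤4L+6⇒M∸1≤L : (M L : ℕ) → 4 * M ≤ 4 * L + 6 → M ∸ 1 ≤ L
4M≤4L+6⇒M∸1≤L M L bound = ∸-monoˡ-≤ 1 (≤-pred (*-cancelˡ-< 4 M (2 + L) 4M<4[2+L]))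
  where
  open ≤-Reasoning
  e : ∀ L → 4 * L + 8 ≡ 4 * (2 + L)
  e = solve-∀
  4M<4[2+L] : 4 * M < 4 * (2 + L)
  4M<4[2+L] = begin-strict
    4 * M       ≤⟨ bound ⟩
    4 * L + 6   <⟨ +-monoʳ-< (4 * L) (≤ᵇ⇒≤ 7 8 tt) ⟩
    4 * L + 8   ≡⟨ e L ⟩
    4 * (2 + L) ∎

theorem5 : (a b c : ℕ) → 1 ≤ a → a ≤ b → b ≤ c → 3 * a ≡ b + c →
    ¬ (a , b , c) ≡ (4 , 6 , 6) →
    MetricDim a b c (((a + b + c) / 2) ∸ 1)
theorem5 a b c 1≤a a≤b b≤c 3a≡b+c not-466 with parametrise a≤b b≤c 3a≡b+c
... | m , d , refl , refl , refl =
  subst (MetricDim a' b' c') (cong (_∸ 1) (sym half)) (upper-bound m d 1≤a excluded , lower)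
  where
  a' = 2 * m + d
  b' = 3 * m + d
  c' = 3 * m + 2 * d
  sum≡ : ∀ m d → (2 * m + d) + (3 * m + d) + (3 * m + 2 * d) ≡ ((2 * m + d) + (2 * m + d)) * 2
  sum≡ = solve-∀
  half : (a' + b' + c') / 2 ≡ a' + a'
  half = trans (cong (_/ 2) (sum≡ m d)) (m*n/n≡m (a' + a') 2)
  excluded : ¬ (m ≡ 2 × d ≡ 0)
  excluded (refl , refl) = not-466 refl
  point : {n : ℕ} → 1 ≤ n → Fin n
  point {suc _} _ = zero
  origin : Vertex a' b' c'
  origin = point 1≤a , point (≤-trans 1≤a a≤b) , point (≤-trans 1≤a (≤-trans a≤b b≤c))
  double-sum≡ : ∀ m d → let s = (2 * m + d) + (3 * m + d) + (3 * m + 2 * d) in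
                s + s ≡ 4 * ((2 * m + d) + (2 * m + d))
  double-sum≡ = solve-∀
  lower : (U : List (Vertex a' b' c')) → Unique U → Resolving U → a' + a' ∸ 1 ≤ length U
  lower U unique resolving =
    4M≤4L+6⇒M∸1≤L (a' + a') (length U)
      (subst (_≤ 4 * length U + 6) (double-sum≡ m d) (lower-bound origin U unique resolving))
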